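{- Let $X$ be a finite set with $|X|\ge2$, let $\mathcal{H}$ be a hierarchy on $X$ with corresponding rooted phylogenetic tree $T$, and let $\mathcal{P}$ be a partition of $X$. Then $\mathcal{H}$ and $\mathcal{P}$ are compatible if and only if the unrooted tree $\overline{T}$ obtained from $T$ by forgetting the root (and suppressing the root if it has degree two) is compatible with $\mathcal{P}$.
   Context: A rooted phylogenetic tree $T$ on $X$ is a rooted tree with leaf set $X$ in which every non-leaf vertex has at least two children (so the root may have degree two). A hierarchy on $X$ is a set system $\mathcal{H}\subseteq 2^X$ with $\emptyset\notin\mathcal{H}$, $X\in\mathcal{H}$, all singletons in $\mathcal{H}$, and no two members overlapping; it corresponds to the unique rooted phylogenetic tree $T$ with $\mathcal{H}=\{L(T(v)):v\in V(T)\}$. Suppressing a degree-two vertex $\rho$ with neighbors $v_1,v_2$ means deleting $\rho$ and adding the edge $\{v_1,v_2\}$. For a tree $T$ with leaf set $X$ and $H\subseteq E(T)$, $\mathcal{F}(T,H)$ is the partition of $X$ into leaf sets of the connected components of $T-H$; $\mathcal{P}$ and a tree are compatible if $\mathcal{P}=\mathcal{F}(T,H)$ for some edge set $H$, and $\mathcal{P}$ and $\mathcal{H}$ are compatible if $\mathcal{P}$ and the tree of $\mathcal{H}$ are. -}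

module Defs where

open import Level using (0ℓ)
open import Data.Nat using (ℕ)
open import Data.Fin using (Fin)
open import Data.Bool using (Bool; T; not; _∧_)
open import Data.Fin.Subset
  using (Subset; _∈_; _⊆_; _⊂_; _∩_; ⁅_⁆; Empty; Nonempty)
  renaming (⊥ to ∅; ⊤ to Full)
open import Data.Vec.Properties using (≡-dec)
import Data.Bool as B
open import Data.Product using (Σ; ∃; _×_; _,_; proj₁)
open import Data.Sum using (_⊎_)
open import Data.Empty using (⊥)
open import Relation.Nullary using (¬_)
open import Relation.Nullary.Decidable using (⌊_⌋)
open import Relation.Binary.PropositionalEquality using (_≡_; _≢_)
open import Relation.Binary.Construct.Closure.ReflexiveTransitive using (Star)

-- A (finite) set system on X = Fin n, given by a Boolean membership test
-- (Boolean membership makes membership proofs proof-irrelevant).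
SetSystem : ℕ → Set
SetSystem n = Subset n → Bool

_∈ₛ_ : ∀ {n} → Subset n → SetSystem n → Set
A ∈ₛ 𝓢 = T (𝓢 A)

record Hierarchy (n : ℕ) : Set where
  field
    mem        : SetSystem n
    noEmpty    : ¬ (∅ ∈ₛ mem)
    hasFull    : Full ∈ₛ mem
    singletons : ∀ (x : Fin n) → ⁅ x ⁆ ∈ₛ mem
    laminar    : ∀ A B → A ∈ₛ mem → B ∈ₛ mem → A ⊆ B ⊎ B ⊆ A ⊎ Empty (A ∩ B)
open Hierarchy public

record Partition (n : ℕ) : Set where
  field
    block     : SetSystem n
    nonempty  : ∀ A → A ∈ₛ block → Nonempty A
    disjoint  : ∀ A B → A ∈ₛ block → B ∈ₛ block → A ≡ B ⊎ Empty (A ∩ B)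
    covers    : ∀ (x : Fin n) → ∃ λ A → A ∈ₛ block × x ∈ A
open Partition public

-- An (undirected, simple) graph with leaves labelled by X = Fin n.
-- Adj lists each edge (in at least one orientation); Leaf x v says
-- vertex v is the leaf labelled x.
record Graph (n : ℕ) : Set₁ where
  field
    V    : Set
    Adj  : V → V → Set
    Leaf : Fin n → V → Set
open Graph public

-- An edge set H ⊆ E(G), given by its endpoints (unordered: the edge {u,v}
-- is in H if Cut u v or Cut v u).
EdgeSet : ∀ {n} → Graph n → Set₁
EdgeSet G = V G → V G → Set

Step : ∀ {n} (G : Graph n) → EdgeSet G → V G → V G → Set
Step G H u v = (Adj G u v ⊎ Adj G v u) × ¬ (H u v ⊎ H v u)

Conn : ∀ {n} (G : Graph n) → EdgeSet G → V G → V G → Set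
Conn G H = Star (Step G H)

-- S ∈ 𝓕(G,H): S is the (nonempty) leaf set of some component of G - H.
InF : ∀ {n} (G : Graph n) → EdgeSet G → Subset n → Set
InF G H S = Nonempty S × ∃ λ w → ∀ x →
  (x ∈ S → ∃ λ v → Leaf G x v × Conn G H v w) ×
  ((∃ λ v → Leaf G x v × Conn G H v w) → x ∈ S)

CompatibleG : ∀ {n} → Partition n → Graph n → Set₁
CompatibleG P G = ∃ λ (H : EdgeSet G) → ∀ S →
  (S ∈ₛ block P → InF G H S) × (InF G H S → S ∈ₛ block P)

module _ {n : ℕ} (𝓗 : Hierarchy n) where

  -- B covers A in 𝓗: A ⊂ B, both in 𝓗, nothing of 𝓗 strictly between.
  -- These are exactly the (child, parent) edges of the tree of 𝓗.
  Cover : Subset n → Subset n → Set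
  Cover A B = A ∈ₛ mem 𝓗 × B ∈ₛ mem 𝓗 × A ⊂ B ×
              ¬ (∃ λ C → C ∈ₛ mem 𝓗 × A ⊂ C × C ⊂ B)

  -- The rooted phylogenetic tree T of 𝓗 (vertices = clusters,
  -- root = X, leaves = singletons), viewed as a graph.
  rootedTree : Graph n
  rootedTree = record
    { V    = Σ (Subset n) (λ A → A ∈ₛ mem 𝓗)
    ; Adj  = λ u v → Cover (proj₁ u) (proj₁ v)
    ; Leaf = λ x v → proj₁ v ≡ ⁅ x ⁆ }

  record RootDeg2 : Set where
    field
      a b   : Subset n
      a-ch  : Cover a Full
      b-ch  : Cover b Full
      a≢b   : a ≢ b
      only  : ∀ C → Cover C Full → C ≡ a ⊎ C ≡ b

  suppressedTree : RootDeg2 → Graph n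
  suppressedTree w = record
    { V    = Σ (Subset n) (λ A → T (mem 𝓗 A ∧ not ⌊ ≡-dec B._≟_ A Full ⌋))
    ; Adj  = λ u v → Cover (proj₁ u) (proj₁ v) ⊎
                     (proj₁ u ≡ RootDeg2.a w × proj₁ v ≡ RootDeg2.b w)
    ; Leaf = λ x v → proj₁ v ≡ ⁅ x ⁆ }

  -- 𝓟 compatible with the unrooted tree T̄: if the root has degree two,
  -- T̄ is the suppressed tree; otherwise T̄ is T with the root forgotten
  -- (as an undirected graph this is rootedTree itself).
  CompatibleUnrooted : Partition n → Set₁
  CompatibleUnrooted P =
    (∀ (w : RootDeg2) → CompatibleG P (suppressedTree w)) ×
    (¬ RootDeg2 → CompatibleG P rootedTree)

CompatibleH : ∀ {n} → Partition n → Hierarchy n → Set₁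
CompatibleH P 𝓗 = CompatibleG P (rootedTree 𝓗)

-- Cutting edges of T and of the suppressed tree T̄ yields the same leaf components once the cuts
-- are matched: edges away from the root are common to both trees, and the new edge {a, b} of T̄
-- counts as cut exactly when one of the root edges {a, ρ}, {b, ρ} of T is. A path of T̄ through
-- {a, b} expands to a – ρ – b in T; a path of T entering the root ρ leaves it through a or b,
-- so it either returns where it came from or crosses {a, b} in T̄. If the root does not have
-- degree two, T̄ is T itself.
module Submission where

open import Defs
open import Data.Nat using (ℕ; _≤_)
open import Data.Nat.Properties using (<⇒≢)
open import Data.Product using (_×_; _,_; proj₁; proj₂; Σ; ∃; ∃₂)
open import Data.Sum using (_⊎_; inj₁; inj₂; swap; [_,_]′)
import Data.Sum as Sum
open import Data.Empty using (⊥-elim)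
open import Data.Bool using (Bool; T; not; _∧_)
open import Data.Bool.Properties using (T-irrelevant; T-∧)
import Data.Bool as Bool
open import Data.Fin using (Fin)
open import Data.Fin.Subset using (Subset; _∈_; _⊂_; ⁅_⁆; ∣_∣) renaming (⊤ to Full)
open import Data.Fin.Subset.Properties using (∈⊤; ∣⊤∣≡n; ∣⁅x⁆∣≡1; _⊂?_; anySubset?)
open import Data.Vec.Properties using (≡-dec)
open import Function using (_∘_; id)
open import Function.Bundles using (_⇔_; mk⇔; Equivalence)
open import Relation.Nullary using (¬_; Dec; yes; no)
open import Relation.Nullary.Decidable
  using (⌊_⌋; _×-dec_; _⊎-dec_; ¬?; T?; map′; decidable-stable; fromWitnessFalse; toWitnessFalse)
open import Relation.Binary.PropositionalEquality using (_≡_; _≢_; refl; sym; trans; cong; module ≡-Reasoning)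
open import Relation.Binary.Construct.Closure.ReflexiveTransitive
  using (ε; _◅_; _◅◅_; reverse; kleisliStar)

open Equivalence using (to; from)

module _ {n : ℕ} (G : Graph n) where

  Edge : V G → V G → Set
  Edge u v = Adj G u v ⊎ Adj G v u

  Cut : EdgeSet G → V G → V G → Set
  Cut H u v = H u v ⊎ H v u

  module _ (H : EdgeSet G) where

    Step-sym : ∀ {u v} → Step G H u v → Step G H v u
    Step-sym (e , u≁v) = swap e , u≁v ∘ swap

    Conn-sym : ∀ {u v} → Conn G H u v → Conn G H v u
    Conn-sym = reverse Step-sym

module Transport {n : ℕ} {G G' : Graph n} (ι : V G' → V G)
  (leaf-ι : ∀ x v → Leaf G' x v ⇔ Leaf G x (ι v))
  (leaf-image : ∀ {x v} → Leaf G x v → ∃ λ v' → ι v' ≡ v) where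

  ConnAlong : EdgeSet G → EdgeSet G' → Set
  ConnAlong H H' = ∀ x y → Conn G' H' x y ⇔ Conn G H (ι x) (ι y)

  module _ {H : EdgeSet G} {H' : EdgeSet G'} (conn : ConnAlong H H') where

    InF-restrict : ∀ {S} → InF G H S → InF G' H' S
    InF-restrict {S} (nonempty@(x₀ , x₀∈S) , w , component) with proj₁ (component x₀) x₀∈S
    ... | v₀ , leaf₀ , v₀~w with leaf-image leaf₀
    ...   | w' , refl = nonempty , w' , λ x → inward x , outward x
      where
      inward : ∀ x → x ∈ S → ∃ λ v' → Leaf G' x v' × Conn G' H' v' w'
      inward x x∈S with proj₁ (component x) x∈S
      ... | v , leaf , v~w with leaf-image leaf
      ...   | v' , refl = v' , from (leaf-ι x v') leaf , from (conn v' w') (v~w ◅◅ Conn-sym G H v₀~w)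

      outward : ∀ x → (∃ λ v' → Leaf G' x v' × Conn G' H' v' w') → x ∈ S
      outward x (v' , leaf' , v'~w') =
        proj₂ (component x) (ι v' , to (leaf-ι x v') leaf' , to (conn v' w') v'~w' ◅◅ v₀~w)

    InF-extend : ∀ {S} → InF G' H' S → InF G H S
    InF-extend {S} (nonempty , w' , component) = nonempty , ι w' , λ x → inward x , outward x
      where
      inward : ∀ x → x ∈ S → ∃ λ v → Leaf G x v × Conn G H v (ι w')
      inward x x∈S with proj₁ (component x) x∈S
      ... | v' , leaf' , v'~w' = ι v' , to (leaf-ι x v') leaf' , to (conn v' w') v'~w'

      outward : ∀ x → (∃ λ v → Leaf G x v × Conn G H v (ι w')) → x ∈ S
      outward x (v , leaf , v~w) with leaf-image leaf
      ... | v' , refl = proj₂ (component x) (v' , from (leaf-ι x v') leaf , from (conn v' w') v~w)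

  compatible-transport : (∀ H → ∃ λ H' → ConnAlong H H') → (∀ H' → ∃ λ H → ConnAlong H H') →
    ∀ P → CompatibleG P G ⇔ CompatibleG P G'
  compatible-transport restrict extend P = mk⇔ compatible-restrict compatible-extend
    where
    compatible-restrict : CompatibleG P G → CompatibleG P G'
    compatible-restrict (H , blocks) with restrict H
    ... | H' , conn = H' , λ S → InF-restrict conn ∘ proj₁ (blocks S) , proj₂ (blocks S) ∘ InF-extend conn

    compatible-extend : CompatibleG P G' → CompatibleG P G
    compatible-extend (H' , blocks) with extend H'
    ... | H , conn = H , λ S → InF-extend conn ∘ proj₁ (blocks S) , proj₂ (blocks S) ∘ InF-restrict conn

record Suppression {n : ℕ} (G G' : Graph n) : Set where
  field
    ι            : V G' → V G
    ι-injective  : ∀ {x y} → ι x ≡ ι y → x ≡ y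
    r            : V G
    ι≢r          : ∀ x → ι x ≢ r
    ι-onto       : ∀ v → v ≢ r → ∃ λ x → ι x ≡ v
    _≟r          : ∀ v → Dec (v ≡ r)
    a b          : V G'
    a–r          : Edge G (ι a) r
    b–r          : Edge G (ι b) r
    r-neighbours : ∀ {v} → Edge G r v → v ≡ ι a ⊎ v ≡ ι b
    ¬a–b         : ¬ Edge G (ι a) (ι b)
    a–b          : Edge G' a b
    ι-edge       : ∀ {x y} → Edge G (ι x) (ι y) → Edge G' x y
    edge-ι       : ∀ {x y} → Edge G' x y → Edge G (ι x) (ι y) ⊎ (x ≡ a × y ≡ b) ⊎ (x ≡ b × y ≡ a)
    leaf-ι       : ∀ x v → Leaf G' x v ⇔ Leaf G x (ι v)
    leaf≢r       : ∀ {x v} → Leaf G x v → v ≢ r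

module _ {n : ℕ} {G G' : Graph n} (sup : Suppression G G') where
  open Suppression sup

  record Matching (H : EdgeSet G) (H' : EdgeSet G') : Set where
    field
      uncut-ι  : ∀ {x y} → Edge G (ι x) (ι y) → (¬ Cut G H (ι x) (ι y)) ⇔ (¬ Cut G' H' x y)
      uncut-ab : (¬ Cut G' H' a b) ⇔ (¬ Cut G H (ι a) r × ¬ Cut G H (ι b) r)

  module _ {H : EdgeSet G} {H' : EdgeSet G'} (matching : Matching H H') where
    open Matching matching

    conn-ι : ∀ {x y} → Conn G' H' x y → Conn G H (ι x) (ι y)
    conn-ι = kleisliStar ι step-ι
      where
      a~b : ¬ Cut G' H' a b → Conn G H (ι a) (ι b)
      a~b a≁b with to uncut-ab a≁b
      ... | a≁r , b≁r = (a–r , a≁r) ◅ Step-sym G H (b–r , b≁r) ◅ ε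

      step-ι : ∀ {x y} → Step G' H' x y → Conn G H (ι x) (ι y)
      step-ι (e , x≁y) with edge-ι e
      ... | inj₁ e' = (e' , from (uncut-ι e') x≁y) ◅ ε
      ... | inj₂ (inj₁ (refl , refl)) = a~b x≁y
      ... | inj₂ (inj₂ (refl , refl)) = Conn-sym G H (a~b (x≁y ∘ swap))

    -- r has no counterpart in G', so it is reached through an uncut edge from a reached neighbour.
    Reached : V G' → V G → Set
    Reached x₀ w = ∃ λ x → Conn G' H' x₀ x × (ι x ≡ w ⊎ (w ≡ r × Step G H (ι x) r))

    r-neighbour : ∀ {x} → Edge G (ι x) r → x ≡ a ⊎ x ≡ b
    r-neighbour = Sum.map ι-injective ι-injective ∘ r-neighbours ∘ swap

    through-r : ∀ {x y} → Step G H (ι x) r → Step G H r (ι y) → Conn G' H' x y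
    through-r (ex , x≁r) (ey , r≁y) with r-neighbour ex | r-neighbour (swap ey)
    ... | inj₁ refl | inj₁ refl = ε
    ... | inj₂ refl | inj₂ refl = ε
    ... | inj₁ refl | inj₂ refl = (a–b , from uncut-ab (x≁r , r≁y ∘ swap)) ◅ ε
    ... | inj₂ refl | inj₁ refl = Conn-sym G' H' ((a–b , from uncut-ab (r≁y ∘ swap , x≁r)) ◅ ε)

    step-reached : ∀ {x₀ v w} → Step G H v w → Reached x₀ v → Reached x₀ w
    step-reached {w = w} s (x , x₀~x , inj₁ refl) with w ≟r
    ... | yes refl = x , x₀~x , inj₂ (refl , s)
    ... | no w≢r with ι-onto w w≢r
    ...   | y , refl = y , x₀~x ◅◅ (ι-edge (proj₁ s) , to (uncut-ι (proj₁ s)) (proj₂ s)) ◅ ε , inj₁ refl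
    step-reached {w = w} s (x , x₀~x , inj₂ (refl , x–r)) with w ≟r
    ... | yes refl = x , x₀~x , inj₂ (refl , x–r)
    ... | no w≢r with ι-onto w w≢r
    ...   | y , refl = y , x₀~x ◅◅ through-r x–r s , inj₁ refl

    reached : ∀ {x₀ v w} → Conn G H v w → Reached x₀ v → Reached x₀ w
    reached ε         = id
    reached (s ◅ v~w) = reached v~w ∘ step-reached s

    ι-conn : ∀ {x y} → Conn G H (ι x) (ι y) → Conn G' H' x y
    ι-conn {x} {y} ιx~ιy with reached ιx~ιy (x , ε , inj₁ refl)
    ... | z , x~z , inj₁ ιz≡ιy with ι-injective ιz≡ιy
    ...   | refl = x~z
    ι-conn {x} {y} ιx~ιy | z , _ , inj₂ (ιy≡r , _) = ⊥-elim (ι≢r y ιy≡r)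

    conn-along : ∀ x y → Conn G' H' x y ⇔ Conn G H (ι x) (ι y)
    conn-along x y = mk⇔ conn-ι ι-conn

  restrictCut : EdgeSet G → EdgeSet G'
  restrictCut H x y = (Edge G (ι x) (ι y) × H (ι x) (ι y))
                    ⊎ (x ≡ a × y ≡ b × (Cut G H (ι a) r ⊎ Cut G H (ι b) r))

  restrictCut-matching : ∀ H → Matching H (restrictCut H)
  restrictCut-matching H = record
    { uncut-ι  = λ e → mk⇔ (uncut-restricted e) (λ x≁y → x≁y ∘ Sum.map (inj₁ ∘ (e ,_)) (inj₁ ∘ (swap e ,_)))
    ; uncut-ab = mk⇔ (λ a≁b → a≁b ∘ cut-ab ∘ inj₁ , a≁b ∘ cut-ab ∘ inj₂) uncut-ab }
    where
    uncut-restricted : ∀ {x y} → Edge G (ι x) (ι y) → ¬ Cut G H (ι x) (ι y) → ¬ Cut G' (restrictCut H) x y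
    uncut-restricted e x≁y (inj₁ (inj₁ (_ , h)))           = x≁y (inj₁ h)
    uncut-restricted e x≁y (inj₂ (inj₁ (_ , h)))           = x≁y (inj₂ h)
    uncut-restricted e _   (inj₁ (inj₂ (refl , refl , _))) = ¬a–b e
    uncut-restricted e _   (inj₂ (inj₂ (refl , refl , _))) = ¬a–b (swap e)

    cut-ab : Cut G H (ι a) r ⊎ Cut G H (ι b) r → Cut G' (restrictCut H) a b
    cut-ab c = inj₁ (inj₂ (refl , refl , c))

    uncut-ab : ¬ Cut G H (ι a) r × ¬ Cut G H (ι b) r → ¬ Cut G' (restrictCut H) a b
    uncut-ab _           (inj₁ (inj₁ (e , _)))     = ¬a–b e
    uncut-ab _           (inj₂ (inj₁ (e , _)))     = ¬a–b (swap e)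
    uncut-ab (a≁r , b≁r) (inj₁ (inj₂ (_ , _ , c))) = [ a≁r , b≁r ]′ c
    uncut-ab (a≁r , b≁r) (inj₂ (inj₂ (_ , _ , c))) = [ a≁r , b≁r ]′ c

  extendCut : EdgeSet G' → EdgeSet G
  extendCut H' u v = (∃₂ λ x y → ι x ≡ u × ι y ≡ v × H' x y)
                   ⊎ (u ≡ ι a × v ≡ r × Cut G' H' a b)

  extendCut-matching : ∀ H' → Matching (extendCut H') H'
  extendCut-matching H' = record
    { uncut-ι  = λ _ → mk⇔ (λ x≁y → x≁y ∘ Sum.map (extended refl refl) (extended refl refl)) uncut-extended
    ; uncut-ab = mk⇔ (λ a≁b → a≁b ∘ cut-r , a≁b ∘ cut-r) (λ (a≁r , _) → a≁r ∘ cut-a) }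
    where
    extended : ∀ {x y u v} → ι x ≡ u → ι y ≡ v → H' x y → extendCut H' u v
    extended ιx≡u ιy≡v h = inj₁ (_ , _ , ιx≡u , ιy≡v , h)

    uncut-extended : ∀ {x y} → ¬ Cut G' H' x y → ¬ Cut G (extendCut H') (ι x) (ι y)
    uncut-extended {x} {y} x≁y (inj₁ (inj₁ (x' , y' , ιx'≡ιx , ιy'≡ιy , h)))
      with ι-injective ιx'≡ιx | ι-injective ιy'≡ιy
    ... | refl | refl = x≁y (inj₁ h)
    uncut-extended {x} {y} x≁y (inj₂ (inj₁ (y' , x' , ιy'≡ιy , ιx'≡ιx , h)))
      with ι-injective ιx'≡ιx | ι-injective ιy'≡ιy
    ... | refl | refl = x≁y (inj₂ h)
    uncut-extended {y = y} _ (inj₁ (inj₂ (_ , ιy≡r , _))) = ι≢r y ιy≡r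
    uncut-extended {x = x} _ (inj₂ (inj₂ (_ , ιx≡r , _))) = ι≢r x ιx≡r

    cut-a : Cut G' H' a b → Cut G (extendCut H') (ι a) r
    cut-a c = inj₁ (inj₂ (refl , refl , c))

    cut-r : ∀ {z} → Cut G (extendCut H') (ι z) r → Cut G' H' a b
    cut-r (inj₁ (inj₁ (_ , y , _ , ιy≡r , _))) = ⊥-elim (ι≢r y ιy≡r)
    cut-r (inj₂ (inj₁ (x , _ , ιx≡r , _ , _))) = ⊥-elim (ι≢r x ιx≡r)
    cut-r (inj₁ (inj₂ (_ , _ , c)))            = c
    cut-r {z} (inj₂ (inj₂ (_ , ιz≡r , _)))     = ⊥-elim (ι≢r z ιz≡r)

  compatible-suppression : ∀ P → CompatibleG P G ⇔ CompatibleG P G'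
  compatible-suppression = compatible-transport
    (λ H → restrictCut H , conn-along (restrictCut-matching H))
    (λ H' → extendCut H' , conn-along (extendCut-matching H'))
    where open Transport ι leaf-ι (λ leaf → ι-onto _ (leaf≢r leaf))

proj₁-injective : ∀ {n} {P : Subset n → Bool} {u v : Σ (Subset n) (T ∘ P)} → proj₁ u ≡ proj₁ v → u ≡ v
proj₁-injective {u = A , p} {v = .A , q} refl = cong (A ,_) (T-irrelevant p q)

⁅x⁆≢Full : ∀ {n} → 2 ≤ n → (x : Fin n) → ⁅ x ⁆ ≢ Full
⁅x⁆≢Full {n} 2≤n x ⁅x⁆≡Full = <⇒≢ 2≤n (begin
  1            ≡⟨ sym (∣⁅x⁆∣≡1 x) ⟩
  ∣ ⁅ x ⁆ ∣    ≡⟨ cong ∣_∣ ⁅x⁆≡Full ⟩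
  ∣ Full {n} ∣ ≡⟨ ∣⊤∣≡n n ⟩
  n            ∎)
  where open ≡-Reasoning

Full⊄ : ∀ {n} {A : Subset n} → ¬ (Full ⊂ A)
Full⊄ (_ , _ , _ , x∉Full) = x∉Full ∈⊤

_≟ₛ_ : ∀ {n} (A B : Subset n) → Dec (A ≡ B)
_≟ₛ_ = ≡-dec Bool._≟_

module RootedTree {n : ℕ} (𝓗 : Hierarchy n) where

  cover? : ∀ A B → Dec (Cover 𝓗 A B)
  cover? A B = T? (mem 𝓗 A) ×-dec T? (mem 𝓗 B) ×-dec A ⊂? B ×-dec
    ¬? (anySubset? λ C → T? (mem 𝓗 C) ×-dec A ⊂? C ×-dec C ⊂? B)

  rootDeg2? : Dec (RootDeg2 𝓗)
  rootDeg2? = map′ fromSearch toSearch (anySubset? λ A → anySubset? λ B →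
    cover? A Full ×-dec cover? B Full ×-dec ¬? (A ≟ₛ B) ×-dec
    ¬? (anySubset? λ C → cover? C Full ×-dec ¬? (C ≟ₛ A ⊎-dec C ≟ₛ B)))
    where
    Search : Set
    Search = ∃₂ λ A B → Cover 𝓗 A Full × Cover 𝓗 B Full × A ≢ B ×
                        ¬ (∃ λ C → Cover 𝓗 C Full × ¬ (C ≡ A ⊎ C ≡ B))

    fromSearch : Search → RootDeg2 𝓗
    fromSearch (A , B , A-ch , B-ch , A≢B , noOther) = record
      { a = A ; b = B ; a-ch = A-ch ; b-ch = B-ch ; a≢b = A≢B
      ; only = λ C C-ch → decidable-stable (C ≟ₛ A ⊎-dec C ≟ₛ B) (λ C∉ → noOther (C , C-ch , C∉)) }

    toSearch : RootDeg2 𝓗 → Search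
    toSearch w = a , b , a-ch , b-ch , a≢b , λ (C , C-ch , C∉) → C∉ (only C C-ch)
      where open RootDeg2 w

  child≢Full : ∀ {A} → Cover 𝓗 A Full → A ≢ Full
  child≢Full (_ , _ , A⊂Full , _) refl = Full⊄ A⊂Full

  ProperCluster : Subset n → Set
  ProperCluster A = T (mem 𝓗 A ∧ not ⌊ A ≟ₛ Full ⌋)

  proper-cluster : ∀ {A} → A ∈ₛ mem 𝓗 → A ≢ Full → ProperCluster A
  proper-cluster A∈𝓗 A≢Full = from T-∧ (A∈𝓗 , fromWitnessFalse A≢Full)

  proper-cluster-∈ : ∀ {A} → ProperCluster A → A ∈ₛ mem 𝓗
  proper-cluster-∈ {A} = proj₁ ∘ to (T-∧ {mem 𝓗 A})

  proper-cluster-≢ : ∀ {A} → ProperCluster A → A ≢ Full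
  proper-cluster-≢ {A} = toWitnessFalse ∘ proj₂ ∘ to (T-∧ {mem 𝓗 A})

  module _ (two : 2 ≤ n) (w : RootDeg2 𝓗) where
    open RootDeg2 w

    root-suppression : Suppression (rootedTree 𝓗) (suppressedTree 𝓗 w)
    root-suppression = record
      { ι            = ι
      ; ι-injective  = proj₁-injective ∘ cong proj₁
      ; r            = root
      ; ι≢r          = λ x → proper-cluster-≢ (proj₂ x) ∘ cong proj₁
      ; ι-onto       = λ v v≢r → (proj₁ v , proper-cluster (proj₂ v) (v≢r ∘ proj₁-injective)) , proj₁-injective refl
      ; _≟r          = λ v → map′ proj₁-injective (cong proj₁) (proj₁ v ≟ₛ Full)
      ; a            = child a-ch
      ; b            = child b-ch
      ; a–r          = inj₁ a-ch
      ; b–r          = inj₁ b-ch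
      ; r-neighbours = r-neighbours
      ; ¬a–b         = [ below-sibling a-ch b-ch , below-sibling b-ch a-ch ]′
      ; a–b          = inj₁ (inj₂ (refl , refl))
      ; ι-edge       = Sum.map inj₁ inj₁
      ; edge-ι       = edge-ι
      ; leaf-ι       = λ _ _ → mk⇔ id id
      ; leaf≢r       = λ {x} leaf v≡r → ⁅x⁆≢Full two x (trans (sym leaf) (cong proj₁ v≡r))
      }
      where
      G G' : Graph n
      G  = rootedTree 𝓗
      G' = suppressedTree 𝓗 w

      ι : V G' → V G
      ι v = proj₁ v , proper-cluster-∈ (proj₂ v)

      child : ∀ {A} → Cover 𝓗 A Full → V G'
      child {A} A-ch = A , proper-cluster (proj₁ A-ch) (child≢Full A-ch)

      root : V G
      root = Full , hasFull 𝓗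

      r-neighbours : ∀ {v} → Edge G root v → v ≡ ι (child a-ch) ⊎ v ≡ ι (child b-ch)
      r-neighbours (inj₁ (_ , _ , Full⊂v , _)) = ⊥-elim (Full⊄ Full⊂v)
      r-neighbours (inj₂ v-ch) = Sum.map proj₁-injective proj₁-injective (only _ v-ch)

      below-sibling : ∀ {A B} → Cover 𝓗 A Full → Cover 𝓗 B Full → ¬ Cover 𝓗 A B
      below-sibling (_ , _ , _ , A-maximal) (_ , _ , B⊂Full , _) (_ , B∈𝓗 , A⊂B , _) =
        A-maximal (_ , B∈𝓗 , A⊂B , B⊂Full)

      edge-ι : ∀ {x y} → Edge G' x y →
        Edge G (ι x) (ι y) ⊎ (x ≡ child a-ch × y ≡ child b-ch) ⊎ (x ≡ child b-ch × y ≡ child a-ch)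
      edge-ι (inj₁ (inj₁ x-ch)) = inj₁ (inj₁ x-ch)
      edge-ι (inj₂ (inj₁ y-ch)) = inj₁ (inj₂ y-ch)
      edge-ι (inj₁ (inj₂ (x≡a , y≡b))) = inj₂ (inj₁ (proj₁-injective x≡a , proj₁-injective y≡b))
      edge-ι (inj₂ (inj₂ (y≡a , x≡b))) = inj₂ (inj₂ (proj₁-injective x≡b , proj₁-injective y≡a))

proposition6p2 : ∀ {n : ℕ} → 2 ≤ n → (𝓗 : Hierarchy n) (P : Partition n) →
    (CompatibleH P 𝓗 → CompatibleUnrooted 𝓗 P) × (CompatibleUnrooted 𝓗 P → CompatibleH P 𝓗)
proposition6p2 two 𝓗 P = unroot , reroot
  where
  open RootedTree 𝓗

  suppress : ∀ w → CompatibleH P 𝓗 ⇔ CompatibleG P (suppressedTree 𝓗 w)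
  suppress w = compatible-suppression (root-suppression two w) P

  unroot : CompatibleH P 𝓗 → CompatibleUnrooted 𝓗 P
  unroot compatible = (λ w → to (suppress w) compatible) , λ _ → compatible

  reroot : CompatibleUnrooted 𝓗 P → CompatibleH P 𝓗
  reroot (suppressed , unsuppressed) with rootDeg2?
  ... | yes w  = from (suppress w) (suppressed w)
  ... | no ¬w = unsuppressed ¬w
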